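{- If $q \ge n \ge 1$ are integers, then the maximum size of a solvable set of the complete graph $K_n$ with $q$ colors is $n q^{n-1}$.
   Context: $[q] = \{0,1,\dots,q-1\}$. Let $G$ be a graph with vertices $v_1,\dots,v_n$. A hat-guessing strategy for $G$ with $q$ colors assigns to each vertex $v_i$ a guessing function taking the colors (in $[q]$) of the neighbors of $v_i$ to a guess in $[q]$. A set $S \subseteq [q]^n$ of color assignments is a solvable set of $G$ with $q$ colors if there is a strategy such that for every assignment in $S$ at least one vertex guesses its own color correctly. -}

module Defs where

open import Data.Nat using (ℕ)
open import Data.Fin using (Fin)
open import Data.Vec using (Vec; lookup)
open import Data.List using (List)
open import Data.List.Membership.Propositional using (_∈_)
open import Data.Product using (Σ; ∃)
open import Relation.Binary.PropositionalEquality using (_≡_; _≢_)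
open import Level using (0ℓ; suc)

Graph : ℕ → Set₁
Graph n = Fin n → Fin n → Set

K : (n : ℕ) → Graph n
K n i j = i ≢ j

Assignment : ℕ → ℕ → Set
Assignment n q = Vec (Fin q) n

-- A hat-guessing strategy for G with q colours: each vertex i has a
-- guessing function which may only depend on the colours of the
-- neighbours of i (encoded as a function of the full assignment that is
-- invariant under changes outside the neighbourhood of i).
record Strategy {n : ℕ} (G : Graph n) (q : ℕ) : Set where
  field
    guess : Fin n → Assignment n q → Fin q
    local : ∀ i (c c' : Assignment n q) →
            (∀ j → G i j → lookup c j ≡ lookup c' j) →
            guess i c ≡ guess i c'

open Strategy public

Wins : {n q : ℕ} {G : Graph n} → Strategy G q → Assignment n q → Set
Wins s c = ∃ λ i → guess s i c ≡ lookup c i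

-- A set S ⊆ [q]^n (given as a list; distinctness is imposed separately
-- where size matters) is solvable for G with q colours.
Solvable : {n : ℕ} (G : Graph n) (q : ℕ) → List (Assignment n q) → Set
Solvable G q S = Σ (Strategy G q) λ s → ∀ c → c ∈ S → Wins s c

-- Upper bound: if vertex i guesses correctly on c, then c is determined by i together with the
-- colours of the other vertices, since i's guess depends on those colours only. So a solvable
-- set injects into Fin n × [q]^(n-1).
-- Lower bound: vertex i guesses the colour that makes the colour sum ≡ i (mod q). Then every
-- assignment whose colour sum has residue r < n is guessed correctly by vertex r, and for n ≤ q
-- these assignments form n disjoint residue classes of size q^(n-1) each.
module Submission where

open import Defs
open import Data.Nat using (ℕ; _≤_; _*_; _^_; _∸_)
open import Data.List using (List; length)
open import Data.List.Relation.Unary.Unique.Propositional using (Unique)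
open import Data.Product using (Σ; _×_)
open import Relation.Binary.PropositionalEquality using (_≡_)

open import Data.Nat using (zero; suc; _+_; _%_; _<?_; s≤s; z≤n; NonZero)
open import Data.Nat.Properties using (≮⇒≥; <-≤-trans; +-commutativeSemigroup)
open import Algebra.Properties.CommutativeSemigroup +-commutativeSemigroup using (x∙yz≈y∙xz)
open import Data.Nat.DivMod using (_mod_; m%n<n; %-distribˡ-+; m%n%n≡m%n; [m+kn]%n≡m%n; m<n⇒m%n≡m)
open import Data.Nat.Tactic.RingSolver using (solve-∀)
open import Data.Fin using (Fin; zero; suc; toℕ; combine; punchOut)
open import Data.Fin.Properties
  using (toℕ-fromℕ<; toℕ-injective; toℕ<n; combine-injective; pigeonhole; <⇒≢; suc-injective)
open import Data.Vec using (Vec; []; _∷_; lookup; insertAt; removeAt; sum)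
import Data.Vec as Vec
open import Data.Vec.Properties
  using ( ∷-injective; map-insertAt; tabulate∘lookup; tabulate-cong
        ; insertAt-lookup; removeAt-insertAt; insertAt-removeAt; removeAt-punchOut )
open import Data.Vec.Recursive using (Fin[m^n]↔Fin[m]^n)
open import Data.Vec.Recursive.Properties using (↔Vec)
open import Data.List using ([_]; _++_; map; allFin; cartesianProductWith)
import Data.List as List
open import Data.List.Properties using (length-++; length-map; length-tabulate)
open import Data.List.Membership.Propositional using (_∈_)
open import Data.List.Membership.Propositional.Properties using (∈-lookup; ∈-cartesianProductWith⁻)
open import Data.List.Relation.Unary.All as All using ([])
open import Data.List.Relation.Unary.AllPairs using ([]; _∷_)
open import Data.List.Relation.Unary.Unique.Propositional.Properties using (cartesianProductWith⁺; allFin⁺)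
open import Data.Product using (_,_)
open import Function using (_↔_; Inverse; _∘_; id)
open import Function.Properties.Inverse using (↔-sym; ↔-trans)
open import Relation.Nullary using (¬_; yes; no; contradiction)
open import Relation.Binary.PropositionalEquality using (refl; sym; trans; cong; cong₂; _≢_; module ≡-Reasoning)

private
  variable
    A B C : Set
    k m : ℕ

lookup-injective : ∀ {xs : List A} → Unique xs → ∀ i j → List.lookup xs i ≡ List.lookup xs j → i ≡ j
lookup-injective (_ ∷ _)     zero    zero    _  = refl
lookup-injective (x∉xs ∷ _)  zero    (suc j) eq = contradiction eq (All.lookup x∉xs (∈-lookup j))
lookup-injective (x∉xs ∷ _)  (suc i) zero    eq = contradiction (sym eq) (All.lookup x∉xs (∈-lookup i))
lookup-injective (_ ∷ xs!)   (suc i) (suc j) eq = cong suc (lookup-injective xs! i j eq)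

length≤-of-injective-code : ∀ {P : A → Set} {N} {xs : List A} → Unique xs → (∀ {x} → x ∈ xs → P x) →
  (code : ∀ {x} → P x → Fin N) → (∀ {x y} (px : P x) (py : P y) → code px ≡ code py → x ≡ y) →
  length xs ≤ N
length≤-of-injective-code {N = N} {xs} xs! has code code-injective with N <? length xs
... | no N≮len = ≮⇒≥ N≮len
... | yes N<len =
  let i , j , i<j , eq = pigeonhole N<len (λ k → code (has (∈-lookup k)))
  in  contradiction (lookup-injective xs! i j (code-injective _ _ eq)) (<⇒≢ i<j)

length-cartesianProductWith : ∀ (f : A → B → C) xs ys →
  length (cartesianProductWith f xs ys) ≡ length xs * length ys
length-cartesianProductWith f List.[]       ys = refl
length-cartesianProductWith f (x List.∷ xs) ys = begin
  length (map (f x) ys ++ cartesianProductWith f xs ys)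
    ≡⟨ length-++ (map (f x) ys) ⟩
  length (map (f x) ys) + length (cartesianProductWith f xs ys)
    ≡⟨ cong₂ _+_ (length-map (f x) ys) (length-cartesianProductWith f xs ys) ⟩
  length ys + length xs * length ys
    ∎
  where open ≡-Reasoning

vectors : List A → ∀ k → List (Vec A k)
vectors xs zero    = [ [] ]
vectors xs (suc k) = cartesianProductWith _∷_ xs (vectors xs k)

length-vectors : ∀ (xs : List A) k → length (vectors xs k) ≡ length xs ^ k
length-vectors xs zero    = refl
length-vectors xs (suc k) =
  trans (length-cartesianProductWith _∷_ xs (vectors xs k)) (cong (length xs *_) (length-vectors xs k))

vectors⁺ : ∀ {xs : List A} → Unique xs → ∀ k → Unique (vectors xs k)
vectors⁺ xs! zero    = [] ∷ []
vectors⁺ xs! (suc k) = cartesianProductWith⁺ _∷_ ∷-injective xs! (vectors⁺ xs! k)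

sum-insertAt : ∀ (ns : Vec ℕ k) i n → sum (insertAt ns i n) ≡ n + sum ns
sum-insertAt ns        zero    n = refl
sum-insertAt (n' ∷ ns) (suc i) n = trans (cong (n' +_) (sum-insertAt ns i n)) (x∙yz≈y∙xz n' n (sum ns))

[m%d+n]%d≡[m+n]%d : ∀ m n d .{{_ : NonZero d}} → (m % d + n) % d ≡ (m + n) % d
[m%d+n]%d≡[m+n]%d m n d = begin
  (m % d + n) % d           ≡⟨ %-distribˡ-+ (m % d) n d ⟩
  (m % d % d + n % d) % d   ≡⟨ cong (λ t → (t + n % d) % d) (m%n%n≡m%n m d) ⟩
  (m % d + n % d) % d       ≡⟨ sym (%-distribˡ-+ m n d) ⟩
  (m + n) % d               ∎
  where open ≡-Reasoning

lookup-extensional : ∀ (xs ys : Vec A k) → (∀ j → lookup xs j ≡ lookup ys j) → xs ≡ ys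
lookup-extensional xs ys eq = trans (sym (tabulate∘lookup xs)) (trans (tabulate-cong eq) (tabulate∘lookup ys))

removeAt-cong : ∀ (xs ys : Vec A (suc k)) i → (∀ j → i ≢ j → lookup xs j ≡ lookup ys j) →
  removeAt xs i ≡ removeAt ys i
removeAt-cong (x ∷ xs) (y ∷ ys) zero eq = lookup-extensional xs ys (λ j → eq (suc j) λ ())
removeAt-cong (x ∷ xs@(_ ∷ _)) (y ∷ ys@(_ ∷ _)) (suc i) eq =
  cong₂ _∷_ (eq zero λ ()) (removeAt-cong xs ys i (λ j i≢j → eq (suc j) (i≢j ∘ suc-injective)))

removeAt⁻ : ∀ (xs ys : Vec A (suc k)) {i j} → i ≢ j → removeAt xs i ≡ removeAt ys i →
  lookup xs j ≡ lookup ys j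
removeAt⁻ xs ys {i} {j} i≢j eq = begin
  lookup xs j                           ≡⟨ sym (removeAt-punchOut xs i≢j) ⟩
  lookup (removeAt xs i) (punchOut i≢j) ≡⟨ cong (λ zs → lookup zs (punchOut i≢j)) eq ⟩
  lookup (removeAt ys i) (punchOut i≢j) ≡⟨ removeAt-punchOut ys i≢j ⟩
  lookup ys j                           ∎
  where open ≡-Reasoning

Vec↔Fin : ∀ q k → Vec (Fin q) k ↔ Fin (q ^ k)
Vec↔Fin q k = ↔-sym (↔-trans (Fin[m^n]↔Fin[m]^n q k) (↔Vec k))

encode-injective : ∀ {q k} {xs ys : Vec (Fin q) k} →
  Inverse.to (Vec↔Fin q k) xs ≡ Inverse.to (Vec↔Fin q k) ys → xs ≡ ys
encode-injective {q = q} {k} {xs} {ys} eq = begin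
  xs               ≡⟨ sym (strictlyInverseʳ xs) ⟩
  from (to xs)     ≡⟨ cong from eq ⟩
  from (to ys)     ≡⟨ strictlyInverseʳ ys ⟩
  ys               ∎
  where open ≡-Reasoning
        open Inverse (Vec↔Fin q k)

module _ {m q : ℕ} {G : Graph (suc m)} (loopless : ∀ i → ¬ G i i) where

  correct-guess-determines : ∀ (s : Strategy G q) {i} {c c' : Assignment (suc m) q} →
    guess s i c ≡ lookup c i → guess s i c' ≡ lookup c' i → removeAt c i ≡ removeAt c' i → c ≡ c'
  correct-guess-determines s {i} {c} {c'} correct correct' rest = begin
    c                                        ≡⟨ sym (insertAt-removeAt c i) ⟩
    insertAt (removeAt c i) i (lookup c i)   ≡⟨ cong₂ (λ w x → insertAt w i x) rest own-colour ⟩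
    insertAt (removeAt c' i) i (lookup c' i) ≡⟨ insertAt-removeAt c' i ⟩
    c'                                       ∎
    where
      open ≡-Reasoning
      agree-on-neighbours : ∀ j → G i j → lookup c j ≡ lookup c' j
      agree-on-neighbours j Gij = removeAt⁻ c c' (λ { refl → loopless i Gij }) rest
      own-colour : lookup c i ≡ lookup c' i
      own-colour = trans (sym correct) (trans (local s i c c' agree-on-neighbours) correct')

  solvable-length-≤ : ∀ (S : List (Assignment (suc m) q)) → Unique S → Solvable G q S →
    length S ≤ suc m * q ^ m
  solvable-length-≤ S S! (s , wins) = length≤-of-injective-code S! (wins _) code code-injective
    where
      code : ∀ {c} → Wins s c → Fin (suc m * q ^ m)
      code {c} (i , _) = combine i (Inverse.to (Vec↔Fin q m) (removeAt c i))
      code-injective : ∀ {c c'} (w : Wins s c) (w' : Wins s c') → code w ≡ code w' → c ≡ c'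
      code-injective (i , correct) (i' , correct') eq with combine-injective i _ i' _ eq
      ... | refl , rest = correct-guess-determines s correct correct' (encode-injective rest)

module Residue (q' : ℕ) where

  private
    q : ℕ
    q = suc q'

  colourSum : Vec (Fin q) k → ℕ
  colourSum c = sum (Vec.map toℕ c)

  colourSum-insertAt : ∀ (w : Vec (Fin q) k) i x → colourSum (insertAt w i x) ≡ toℕ x + colourSum w
  colourSum-insertAt w i x =
    trans (cong sum (map-insertAt toℕ x w i)) (sum-insertAt (Vec.map toℕ w) i (toℕ x))

  -- q' * s ≡ -s (mod q), so the guess cancels the colour sum s and leaves residue r.
  balancing : ℕ → Vec (Fin q) k → Fin q
  balancing r w = (r + q' * colourSum w) mod q

  balancing-residue : ∀ r (w : Vec (Fin q) k) → (toℕ (balancing r w) + colourSum w) % q ≡ r % q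
  balancing-residue r w = begin
    (toℕ ((r + q' * s) mod q) + s) % q ≡⟨ cong (λ t → (t + s) % q) (toℕ-fromℕ< (m%n<n (r + q' * s) q)) ⟩
    ((r + q' * s) % q + s) % q         ≡⟨ [m%d+n]%d≡[m+n]%d (r + q' * s) s q ⟩
    (r + q' * s + s) % q               ≡⟨ cong (_% q) (rearrange r q' s) ⟩
    (r + s * q) % q                    ≡⟨ [m+kn]%n≡m%n r s q ⟩
    r % q                              ∎
    where
      open ≡-Reasoning
      s = colourSum w
      rearrange : ∀ r q' s → r + q' * s + s ≡ r + s * suc q'
      rearrange = solve-∀

  extend : Fin (suc m) → Vec (Fin q) m → Assignment (suc m) q
  extend i w = insertAt w i (balancing (toℕ i) w)

  colourSum-extend : ∀ (i : Fin (suc m)) w → colourSum (extend i w) % q ≡ toℕ i % q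
  colourSum-extend i w =
    trans (cong (_% q) (colourSum-insertAt w i _)) (balancing-residue (toℕ i) w)

  extend-injectiveˡ : suc m ≤ q → ∀ {i j : Fin (suc m)} {w w'} → extend i w ≡ extend j w' → i ≡ j
  extend-injectiveˡ {m} n≤q {i} {j} {w} {w'} eq = toℕ-injective (begin
    toℕ i                       ≡⟨ sym (small-residue i) ⟩
    toℕ i % q                   ≡⟨ sym (colourSum-extend i w) ⟩
    colourSum (extend i w) % q  ≡⟨ cong (λ c → colourSum c % q) eq ⟩
    colourSum (extend j w') % q ≡⟨ colourSum-extend j w' ⟩
    toℕ j % q                   ≡⟨ small-residue j ⟩
    toℕ j                       ∎)
    where
      open ≡-Reasoning
      small-residue : ∀ (i : Fin (suc m)) → toℕ i % q ≡ toℕ i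
      small-residue i = m<n⇒m%n≡m (<-≤-trans (toℕ<n i) n≤q)

  extend-injective : suc m ≤ q → ∀ {i j : Fin (suc m)} {w w'} → extend i w ≡ extend j w' → i ≡ j × w ≡ w'
  extend-injective n≤q {i} {w = w} {w'} eq with refl ← extend-injectiveˡ n≤q eq = refl , (begin
    w                        ≡⟨ sym (removeAt-insertAt w i _) ⟩
    removeAt (extend i w) i  ≡⟨ cong (λ c → removeAt c i) eq ⟩
    removeAt (extend i w') i ≡⟨ removeAt-insertAt w' i _ ⟩
    w'                       ∎)
    where open ≡-Reasoning

  residueStrategy : Strategy (K (suc m)) q
  residueStrategy = record
    { guess = λ i c → balancing (toℕ i) (removeAt c i)
    ; local = λ i c c' agree → cong (balancing (toℕ i)) (removeAt-cong c c' i agree)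
    }

  residueStrategy-wins : ∀ (i : Fin (suc m)) w → Wins residueStrategy (extend i w)
  residueStrategy-wins i w = i , (begin
    balancing (toℕ i) (removeAt (extend i w) i) ≡⟨ cong (balancing (toℕ i)) (removeAt-insertAt w i _) ⟩
    balancing (toℕ i) w                         ≡⟨ sym (insertAt-lookup w i _) ⟩
    lookup (extend i w) i                       ∎)
    where open ≡-Reasoning

  residueSet : ∀ m → List (Assignment (suc m) q)
  residueSet m = cartesianProductWith extend (allFin (suc m)) (vectors (allFin q) m)

  residueSet-solvable : Solvable (K (suc m)) q (residueSet m)
  residueSet-solvable {m} = residueStrategy , wins
    where
      wins : ∀ c → c ∈ residueSet m → Wins residueStrategy c
      wins c c∈S with i , w , _ , _ , refl ← ∈-cartesianProductWith⁻ extend (allFin (suc m)) _ c∈S =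
        residueStrategy-wins i w

  residueSet-unique : suc m ≤ q → Unique (residueSet m)
  residueSet-unique {m} n≤q =
    cartesianProductWith⁺ extend (extend-injective n≤q) (allFin⁺ (suc m)) (vectors⁺ (allFin⁺ q) m)

  length-residueSet : ∀ m → length (residueSet m) ≡ suc m * q ^ m
  length-residueSet m = begin
    length (residueSet m)
      ≡⟨ length-cartesianProductWith extend (allFin (suc m)) (vectors (allFin q) m) ⟩
    length (allFin (suc m)) * length (vectors (allFin q) m)
      ≡⟨ cong₂ _*_ (length-tabulate {n = suc m} id) (length-vectors (allFin q) m) ⟩
    suc m * length (allFin q) ^ m
      ≡⟨ cong (λ l → suc m * l ^ m) (length-tabulate {n = q} id) ⟩
    suc m * q ^ m
      ∎
    where open ≡-Reasoning

mainTheorem11 : (n q : ℕ) → 1 ≤ n → n ≤ q →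
    (Σ (List (Assignment n q)) λ S →
        Unique S × Solvable (K n) q S × length S ≡ n * q ^ (n ∸ 1))
    × ((S : List (Assignment n q)) → Unique S → Solvable (K n) q S →
        length S ≤ n * q ^ (n ∸ 1))
mainTheorem11 (suc m) (suc q') (s≤s z≤n) n≤q =
  (residueSet m , residueSet-unique n≤q , residueSet-solvable , length-residueSet m)
  , solvable-length-≤ (λ i i≢i → i≢i refl)
  where open Residue q'
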